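{- For all integers $2<d_1<d_2$, in the game $i\textsc{ -Mark}(\{1\},\{d_1,d_2\})$ convergence occurs in at most $d_1^2d_2^2+d_2+1$ steps; that is, for every starting position $n\ge 0$ there is some $c'$ with $1\le c'\le d_1^2d_2^2+d_2+1$ such that convergence occurs in $c'$ steps starting at $n$.
   Context: For sets $S,D$ of positive integers with $\min D\ge 2$, the impartial game $i\textsc{ -Mark}(S,D)$ has positions $n\in\mathbb N=\{0,1,2,\dots\}$; from $n$ one may move to $n-s$ for any $s\in S$ with $n-s\ge 0$ (a subtraction follower), and to $n/d$ for any $d\in D$ with $n>0$ and $d\mid n$ (a division follower). $\mathcal G$ denotes the Sprague--Grundy function: $\mathcal G(n)=\operatorname{mex}\{\mathcal G(w): w \text{ a follower of } n\}$, where $\operatorname{mex} A=\min(\mathbb N\setminus A)$. Let $\varphi(n)$ be the number of followers of $n$ and $s=\max S$. A guess seed for starting position $n$ is a tuple $\overline\sigma=(\sigma_n,\dots,\sigma_{n+s-1})$ of integers with $0\le\sigma_i\le\varphi(i)$; $\Sigma_n$ is the set of all such seeds. The guess sequence $\mathcal G_{\overline\sigma}$ is defined by $\mathcal G_{\overline\sigma}(i)=\sigma_i$ for $n\le i<n+s$ and, for $m\ge n+s$, $\mathcal G_{\overline\sigma}(m)=\operatorname{mex}\big(\{\mathcal G_{\overline\sigma}(m-t): t\in S\}\cup\{\mathcal G(m/d): d\in D,\ d\mid m\}\big)$. Convergence occurs in $c$ steps starting at position $n$ if $c\ge s$ and $\mathcal G_{\overline\sigma}(m)=\mathcal G_{\overline\sigma'}(m)$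 for all $\overline\sigma,\overline\sigma'\in\Sigma_n$ and all $n+c\le m<n+c+s$. For a game, convergence occurs in $c$ steps if for every starting position $n$ convergence occurs in at most $c$ steps. -}

module Defs where

open import Data.Nat using (ℕ; zero; suc; _+_; _*_; _∸_; _≤_; _<_; _⊔_; _≟_; _≤?_; _<?_)
open import Data.Nat.Divisibility using (_∣?_; divides)
open import Data.List using (List; []; _∷_; _++_; map; length; foldr; deduplicate; concatMap)
open import Data.List.Membership.DecPropositional _≟_ using (_∈?_)
open import Data.Product using (_×_)
open import Relation.Nullary using (yes; no)
open import Relation.Binary.PropositionalEquality using (_≡_)

-- mex of a finite list: least natural number not in the list.
-- The answer is at most the length of the list, so a search of
-- (length xs) steps starting at 0 suffices.
mexAux : ℕ → ℕ → List ℕ → ℕ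
mexAux zero    k xs = k
mexAux (suc f) k xs with k ∈? xs
... | yes _ = mexAux f (suc k) xs
... | no  _ = k

mex : List ℕ → ℕ
mex xs = mexAux (length xs) 0 xs

subFollowers : List ℕ → ℕ → List ℕ
subFollowers S n = concatMap (λ t → f t (t ≤? n)) S
  where
  f : ∀ t → _ → List ℕ
  f t (yes _) = n ∸ t ∷ []
  f t (no  _) = []

-- the values n/d for d ∈ D with d ∣ n (no positivity condition)
quotients : List ℕ → ℕ → List ℕ
quotients D n = concatMap (λ d → f d (d ∣? n)) D
  where
  f : ∀ d → _ → List ℕ
  f d (yes (divides q _)) = q ∷ []
  f d (no  _) = []

divFollowers : List ℕ → ℕ → List ℕ
divFollowers D zero    = []
divFollowers D (suc n) = quotients D (suc n)

followers : List ℕ → List ℕ → ℕ → List ℕ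
followers S D n = deduplicate _≟_ (subFollowers S n ++ divFollowers D n)

φ : List ℕ → List ℕ → ℕ → ℕ
φ S D n = length (followers S D n)

-- Sprague–Grundy function, by recursion with fuel; all followers are
-- strictly smaller than n (elements of S are ≥ 1, of D are ≥ 2), so fuel
-- suc n suffices to compute 𝒢(n).
𝒢F : List ℕ → List ℕ → ℕ → ℕ → ℕ
𝒢F S D zero    n = 0
𝒢F S D (suc f) n = mex (map (𝒢F S D f) (followers S D n))

𝒢 : List ℕ → List ℕ → ℕ → ℕ
𝒢 S D n = 𝒢F S D (suc n) n

maxS : List ℕ → ℕ
maxS S = foldr _⊔_ 0 S

-- A guess seed for starting position n is represented as a function
-- σ : ℕ → ℕ whose values at n ≤ i < n + s satisfy σ i ≤ φ(i);
-- values outside that window are never used.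
IsSeed : List ℕ → List ℕ → ℕ → (ℕ → ℕ) → Set
IsSeed S D n σ = ∀ i → n ≤ i → i < n + maxS S → σ i ≤ φ S D i

-- guess sequence (with fuel; each recursive call is at m ∸ t < m)
guessF : List ℕ → List ℕ → (ℕ → ℕ) → ℕ → ℕ → ℕ → ℕ
guessF S D σ n zero    m = 0
guessF S D σ n (suc f) m with m <? n + maxS S
... | yes _ = σ m
... | no  _ = mex (map (λ t → guessF S D σ n f (m ∸ t)) S ++ map (𝒢 S D) (quotients D m))

guess : List ℕ → List ℕ → (ℕ → ℕ) → ℕ → ℕ → ℕ
guess S D σ n m = guessF S D σ n (suc m) m

ConvergesIn : List ℕ → List ℕ → ℕ → ℕ → Set
ConvergesIn S D c n =
  maxS S ≤ c ×
  (∀ σ σ' → IsSeed S D n σ → IsSeed S D n σ' →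
    ∀ m → n + c ≤ m → m < n + c + maxS S → guess S D σ n m ≡ guess S D σ' n m)

{-# OPTIONS --safe #-}
-- With S = {1} every guess sequence satisfies g(m+1) = mex({g(m)} ∪ {𝒢(m/d) : d ∈ D, d ∣ m}).
-- So if some quotient m/d has Grundy value 0 while m+1 has no divisor in D, every guess
-- sequence is nonzero at m and therefore 0 at m+1, whatever the seed, and from then on all
-- guess sequences agree. Such an m lies just above any n: pick d ∈ D such that neither d₁ nor
-- d₂ divides d+1 (d₁ works unless d₂ = d₁+1, and then d₂ works since d₁ > 2), and a common
-- multiple y of d₁ and d₂ with n < yd ≤ n + d₁d₂d. If 𝒢(y) = 0 take m = yd; otherwise
-- 𝒢(y+1) = 0, because y is the only follower of y+1, and take m = (y+1)d.
module Submission where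

open import Defs
open import Data.Nat using (ℕ; zero; suc; _+_; _*_; _∸_; _≤_; _<_; _≟_; _<?_; z≤n; s≤s; z<s; NonZero; >-nonZero)
open import Data.Nat.Properties
open import Data.Nat.Divisibility using (_∣_; _∤_; _∣?_; divides; >⇒∤; ∣m+n∣m⇒∣n; ∣-refl; ∣-trans; m∣m*n; n∣m*n)
open import Data.Nat.DivMod using (_%_; _/_; m≡m%n+[m/n]*n; m%n<n)
open import Data.List using (List; []; _∷_; map; length)
open import Data.List.Membership.Propositional using (_∈_)
open import Data.List.Membership.Propositional.Properties using (∈-map⁺)
open import Data.List.Membership.DecPropositional _≟_ using (_∈?_)
open import Data.List.Relation.Unary.Any using (here; there)
open import Data.Product using (Σ; ∃-syntax; _×_; _,_)
open import Data.Sum using (_⊎_; inj₁; inj₂)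
open import Relation.Nullary using (yes; no; contradiction)
open import Relation.Binary.PropositionalEquality

mexAux-≥ : ∀ f k xs → k ≤ mexAux f k xs
mexAux-≥ zero    k xs = ≤-refl
mexAux-≥ (suc f) k xs with k ∈? xs
... | yes _ = ≤-trans (n≤1+n k) (mexAux-≥ f (suc k) xs)
... | no  _ = ≤-refl

0∈⇒mex≢0 : ∀ xs → 0 ∈ xs → mex xs ≢ 0
0∈⇒mex≢0 (x ∷ xs) 0∈xs mex≡0 with 0 ∈? x ∷ xs
... | yes _    = 1+n≰n (subst (1 ≤_) mex≡0 (mexAux-≥ (length xs) 1 (x ∷ xs)))
... | no  0∉xs = 0∉xs 0∈xs

mex[x]≡0 : ∀ {x} → x ≢ 0 → mex (x ∷ []) ≡ 0
mex[x]≡0 {x} x≢0 with 0 ∈? x ∷ []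
... | yes (here 0≡x) = contradiction (sym 0≡x) x≢0
... | no  _          = refl

∈-map⁺-≡ : ∀ {A B : Set} {f : A → B} {x y xs} → x ∈ xs → f x ≡ y → y ∈ map f xs
∈-map⁺-≡ {f = f} x∈xs refl = ∈-map⁺ f x∈xs

S₁ : List ℕ
S₁ = 1 ∷ []

ForcesZero : List ℕ → ℕ → Set
ForcesZero D m = 0 ∈ map (𝒢 S₁ D) (quotients D m) × quotients D (suc m) ≡ []

module _ {D : List ℕ} where

  𝒢-suc≡0 : ∀ {y} → quotients D (suc y) ≡ [] → 𝒢 S₁ D y ≢ 0 → 𝒢 S₁ D (suc y) ≡ 0
  𝒢-suc≡0 no-quotients 𝒢y≢0 rewrite no-quotients = mex[x]≡0 𝒢y≢0

  guess-suc : ∀ σ {n k} → n ≤ k →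
    guess S₁ D σ n (suc k) ≡ mex (guess S₁ D σ n k ∷ map (𝒢 S₁ D) (quotients D (suc k)))
  guess-suc σ {n} {k} n≤k with suc k <? n + maxS S₁
  ... | yes k<n = contradiction (≤-trans (≤-reflexive (+-comm n 1)) (s≤s n≤k)) (<⇒≱ k<n)
  ... | no  _   = refl

  forcesZero⇒guess-suc≡0 : ∀ σ {n m} → n < m → ForcesZero D m → guess S₁ D σ n (suc m) ≡ 0
  forcesZero⇒guess-suc≡0 σ {n} {suc k} (s≤s n≤k) (0∈𝒢[m/D] , no-quotients) = begin
    guess S₁ D σ n (suc (suc k))
      ≡⟨ guess-suc σ (m≤n⇒m≤1+n n≤k) ⟩
    mex (guess S₁ D σ n (suc k) ∷ map (𝒢 S₁ D) (quotients D (suc (suc k))))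
      ≡⟨ cong (λ qs → mex (guess S₁ D σ n (suc k) ∷ map (𝒢 S₁ D) qs)) no-quotients ⟩
    mex (guess S₁ D σ n (suc k) ∷ [])
      ≡⟨ mex[x]≡0 guess≢0 ⟩
    0 ∎
    where
    open ≡-Reasoning
    guess≢0 : guess S₁ D σ n (suc k) ≢ 0
    guess≢0 rewrite guess-suc σ n≤k =
      0∈⇒mex≢0 (guess S₁ D σ n k ∷ map (𝒢 S₁ D) (quotients D (suc k))) (there 0∈𝒢[m/D])

  forcesZero⇒convergesIn : ∀ {n k} → 1 ≤ k → ForcesZero D (n + k) → ConvergesIn S₁ D (suc k) n
  forcesZero⇒convergesIn {n} {k} 1≤k forcesZero = s≤s z≤n , agree
    where
    n<n+k : n < n + k
    n<n+k = subst (_≤ n + k) (+-comm n 1) (+-monoʳ-≤ n 1≤k)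
    agree : ∀ σ σ′ → IsSeed S₁ D n σ → IsSeed S₁ D n σ′ →
      ∀ m → n + suc k ≤ m → m < n + suc k + 1 → guess S₁ D σ n m ≡ guess S₁ D σ′ n m
    agree σ σ′ _ _ m lo hi
      with refl ← ≤-antisym lo (≤-pred (subst (m <_) (+-comm _ 1) hi))
      rewrite +-suc n k
      = trans (forcesZero⇒guess-suc≡0 σ n<n+k forcesZero) (sym (forcesZero⇒guess-suc≡0 σ′ n<n+k forcesZero))

∣⇒∤+ : ∀ {k x r} → k ∣ x → k ∤ r → k ∤ x + r
∣⇒∤+ k∣x k∤r k∣x+r = k∤r (∣m+n∣m⇒∣n k∣x+r k∣x)

∣⇒∤suc : ∀ {k x} → 1 < k → k ∣ x → k ∤ suc x
∣⇒∤suc {k} {x} 1<k k∣x = subst (k ∤_) (+-comm x 1) (∣⇒∤+ k∣x (>⇒∤ 1<k))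

next-multiple : ∀ n P .{{_ : NonZero P}} → ∃[ k ] 1 ≤ k × k ≤ P × P ∣ n + k
next-multiple n P = P ∸ r , m<n⇒0<n∸m (m%n<n n P) , m∸n≤m P r , divides (suc q) n+k≡[1+q]P
  where
  open ≡-Reasoning
  r q : ℕ
  r = n % P
  q = n / P
  n+k≡[1+q]P : n + (P ∸ r) ≡ suc q * P
  n+k≡[1+q]P = begin
    n + (P ∸ r)           ≡⟨ cong (_+ (P ∸ r)) (m≡m%n+[m/n]*n n P) ⟩
    r + q * P + (P ∸ r)   ≡⟨ cong (_+ (P ∸ r)) (+-comm r (q * P)) ⟩
    q * P + r + (P ∸ r)   ≡⟨ +-assoc (q * P) r (P ∸ r) ⟩
    q * P + (r + (P ∸ r)) ≡⟨ cong (q * P +_) (m+[n∸m]≡n (<⇒≤ (m%n<n n P))) ⟩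
    q * P + P             ≡⟨ +-comm (q * P) P ⟩
    suc q * P             ∎

module _ {d₁ d₂ : ℕ} where

  quotients-[] : ∀ {m} → d₁ ∤ m → d₂ ∤ m → quotients (d₁ ∷ d₂ ∷ []) m ≡ []
  quotients-[] {m} d₁∤m d₂∤m with d₁ ∣? m | d₂ ∣? m
  ... | yes d₁∣m | _        = contradiction d₁∣m d₁∤m
  ... | no _     | yes d₂∣m = contradiction d₂∣m d₂∤m
  ... | no _     | no _     = refl

  ∈-quotients : ∀ {d m y} .{{_ : NonZero d}} → d ∈ d₁ ∷ d₂ ∷ [] → m ≡ y * d →
    y ∈ quotients (d₁ ∷ d₂ ∷ []) m
  ∈-quotients {m = m} {y} (here refl) m≡yd with d₁ ∣? m
  ... | yes (divides q m≡qd) = here (*-cancelʳ-≡ y q d₁ (trans (sym m≡yd) m≡qd))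
  ... | no  d₁∤m             = contradiction (divides y m≡yd) d₁∤m
  ∈-quotients {m = m} {y} (there (here refl)) m≡yd with d₁ ∣? m | d₂ ∣? m
  ... | yes _ | yes (divides q m≡qd) = there (here (*-cancelʳ-≡ y q d₂ (trans (sym m≡yd) m≡qd)))
  ... | no  _ | yes (divides q m≡qd) = here (*-cancelʳ-≡ y q d₂ (trans (sym m≡yd) m≡qd))
  ... | _     | no  d₂∤m             = contradiction (divides y m≡yd) d₂∤m

module _ {d₁ d₂ : ℕ} (1<d₁ : 1 < d₁) (1<d₂ : 1 < d₂) where

  private
    D : List ℕ
    D = d₁ ∷ d₂ ∷ []

    instance
      d₁-nonZero : NonZero d₁
      d₁-nonZero = >-nonZero (<-trans z<s 1<d₁)
      d₂-nonZero : NonZero d₂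
      d₂-nonZero = >-nonZero (<-trans z<s 1<d₂)

  nonZero-∈ : ∀ {d} → d ∈ D → NonZero d
  nonZero-∈ (here refl)         = d₁-nonZero
  nonZero-∈ (there (here refl)) = d₂-nonZero

  quotients-suc-[] : ∀ {x} → d₁ ∣ x → d₂ ∣ x → quotients D (suc x) ≡ []
  quotients-suc-[] d₁∣x d₂∣x = quotients-[] (∣⇒∤suc 1<d₁ d₁∣x) (∣⇒∤suc 1<d₂ d₂∣x)

  forcesZero-common-multiple : ∀ {d y} → d ∈ D → d₁ ∤ suc d → d₂ ∤ suc d → d₁ ∣ y → d₂ ∣ y →
    ForcesZero D (y * d) ⊎ ForcesZero D (y * d + d)
  forcesZero-common-multiple {d} {y} d∈D d₁∤1+d d₂∤1+d d₁∣y d₂∣y with 𝒢 S₁ D y ≟ 0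
  ... | yes 𝒢y≡0 =
    inj₁ ( ∈-map⁺-≡ {x = y} (∈-quotients {{nonZero-∈ d∈D}} d∈D refl) 𝒢y≡0
         , quotients-suc-[] (∣-trans d₁∣y (m∣m*n d)) (∣-trans d₂∣y (m∣m*n d)) )
  ... | no  𝒢y≢0 =
    inj₂ ( ∈-map⁺-≡ {x = suc y} (∈-quotients {{nonZero-∈ d∈D}} d∈D (+-comm (y * d) d)) 𝒢[1+y]≡0
         , quotients-[] (∤suc[yd+d] d₁∣y d₁∤1+d) (∤suc[yd+d] d₂∣y d₂∤1+d) )
    where
    𝒢[1+y]≡0 : 𝒢 S₁ D (suc y) ≡ 0
    𝒢[1+y]≡0 = 𝒢-suc≡0 {y = y} (quotients-suc-[] d₁∣y d₂∣y) 𝒢y≢0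
    ∤suc[yd+d] : ∀ {k} → k ∣ y → k ∤ suc d → k ∤ suc (y * d + d)
    ∤suc[yd+d] {k} k∣y k∤1+d = subst (k ∤_) (+-suc (y * d) d) (∣⇒∤+ (∣-trans k∣y (m∣m*n d)) k∤1+d)

  forcesZero-multiple : ∀ {d x} → d ∈ D → d₁ ∤ suc d → d₂ ∤ suc d → d₁ * d₂ * d ∣ x →
    ForcesZero D x ⊎ ForcesZero D (x + d)
  forcesZero-multiple {d} d∈D d₁∤1+d d₂∤1+d (divides j refl) rewrite sym (*-assoc j (d₁ * d₂) d) =
    forcesZero-common-multiple d∈D d₁∤1+d d₂∤1+d (∣-trans (m∣m*n d₂) (n∣m*n j)) (∣-trans (n∣m*n d₁) (n∣m*n j))

  forcesZero-near : ∀ {d} → d ∈ D → d₁ ∤ suc d → d₂ ∤ suc d → ∀ n →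
    ∃[ k ] 1 ≤ k × k ≤ d₁ * d₂ * d + d × ForcesZero D (n + k)
  forcesZero-near {d} d∈D d₁∤1+d d₂∤1+d n
    with k , 1≤k , k≤P , P∣n+k ←
           next-multiple n (d₁ * d₂ * d) {{m*n≢0 (d₁ * d₂) d {{m*n≢0 d₁ d₂}} {{nonZero-∈ d∈D}}}}
    with forcesZero-multiple d∈D d₁∤1+d d₂∤1+d P∣n+k
  ... | inj₁ forcesZero = k , 1≤k , ≤-trans k≤P (m≤m+n _ d) , forcesZero
  ... | inj₂ forcesZero =
    k + d , ≤-trans 1≤k (m≤m+n k d) , +-monoˡ-≤ d k≤P , subst (ForcesZero D) (+-assoc n k d) forcesZero

∃∈D-∤suc : ∀ {d₁ d₂} → 2 < d₁ → d₁ < d₂ → ∃[ d ] d ∈ d₁ ∷ d₂ ∷ [] × d ≤ d₂ × d₁ ∤ suc d × d₂ ∤ suc d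
∃∈D-∤suc {d₁} {d₂} 2<d₁ d₁<d₂ with d₂ ≟ suc d₁
... | no d₂≢1+d₁ =
  d₁ , here refl , <⇒≤ d₁<d₂ , ∣⇒∤suc (<⇒≤ 2<d₁) ∣-refl , >⇒∤ (≤∧≢⇒< d₁<d₂ (≢-sym d₂≢1+d₁))
... | yes refl =
  suc d₁ , there (here refl) , ≤-refl , d₁∤2+d₁ , ∣⇒∤suc (m<n⇒m<1+n (<⇒≤ 2<d₁)) ∣-refl
  where
  d₁∤2+d₁ : d₁ ∤ suc (suc d₁)
  d₁∤2+d₁ = subst (d₁ ∤_) (+-comm d₁ 2) (∣⇒∤+ ∣-refl (>⇒∤ 2<d₁))

convergence-bound : ∀ {d₁ d₂ d k} .{{_ : NonZero d₁}} → d ≤ d₂ → k ≤ d₁ * d₂ * d + d →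
  suc k ≤ d₁ * d₁ * d₂ * d₂ + d₂ + 1
convergence-bound {d₁} {d₂} {d} {k} d≤d₂ k≤B = begin
  suc k                               ≤⟨ s≤s k≤B ⟩
  suc (d₁ * d₂ * d + d)               ≤⟨ s≤s (+-mono-≤ P≤ d≤d₂) ⟩
  suc (d₁ * d₁ * d₂ * d₂ + d₂)        ≡⟨ +-comm 1 _ ⟩
  d₁ * d₁ * d₂ * d₂ + d₂ + 1          ∎
  where
  open ≤-Reasoning
  P≤ : d₁ * d₂ * d ≤ d₁ * d₁ * d₂ * d₂
  P≤ = begin
    d₁ * d₂ * d       ≤⟨ *-monoʳ-≤ (d₁ * d₂) d≤d₂ ⟩
    d₁ * d₂ * d₂      ≤⟨ *-monoˡ-≤ d₂ (*-monoˡ-≤ d₂ (m≤m*n d₁ d₁)) ⟩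
    d₁ * d₁ * d₂ * d₂ ∎

mainTheorem5 : (d₁ d₂ : ℕ) → 2 < d₁ → d₁ < d₂ →
    (n : ℕ) → Σ ℕ (λ c′ → 1 ≤ c′ × c′ ≤ d₁ * d₁ * d₂ * d₂ + d₂ + 1 ×
      ConvergesIn (1 ∷ []) (d₁ ∷ d₂ ∷ []) c′ n)
mainTheorem5 d₁ d₂ 2<d₁ d₁<d₂ n =
  let d , d∈D , d≤d₂ , d₁∤1+d , d₂∤1+d = ∃∈D-∤suc 2<d₁ d₁<d₂
      k , 1≤k , k≤B , forcesZero = forcesZero-near 1<d₁ 1<d₂ d∈D d₁∤1+d d₂∤1+d n
  in suc k , s≤s z≤n , convergence-bound d≤d₂ k≤B , forcesZero⇒convergesIn 1≤k forcesZero
  where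
  1<d₁ : 1 < d₁
  1<d₁ = <⇒≤ 2<d₁
  1<d₂ : 1 < d₂
  1<d₂ = <-trans 1<d₁ d₁<d₂
  instance
    d₁-nonZero : NonZero d₁
    d₁-nonZero = >-nonZero (<-trans z<s 1<d₁)
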